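{- Let $\underline c=(c_1,\ldots,c_n)$ with $c_k\in\{0,\pm1,\ldots,\pm r\}$ and let $\mathcal B(\underline c)$ be the set of words $w_1\cdots w_n$ with $w_k\subseteq\{1,\ldots,r\}$, $|w_k|=c_k$ if $c_k\ge0$, and $w_k\subseteq\{ -1,\ldots,-r\}$, $|w_k|=-c_k$ if $c_k<0$. The isolated vertices of the crystal graph of $\mathcal B(\underline c)$, i.e. the words $w$ with $e_i(w)=0$ and $f_i(w)=0$ for all $1\le i\le r-1$, are precisely the lattice words of the $r$-row rectangular (non-skew) fluctuating tableaux of type $\underline c$.
   Context: Let $\mathcal A_r$ be the set of subsets $S\subseteq\{\pm1,\ldots,\pm r\}$ with all elements of the same sign (including $\emptyset$); $\mathbf e_S=\sum_{s\in S}\mathbf e_s$ if $S$ is positive and $\mathbf e_S=-\sum_{s\in S}\mathbf e_{ -s}$ if negative. An $r$-row non-skew fluctuating tableau of length $n$ is a sequence $0=\lambda^0,\ldots,\lambda^n$ of weakly decreasing vectors in $\mathbb Z^r$ with $\lambda^k=\lambda^{k-1}+\mathbf e_{S_k}$, $S_k\in\mathcal A_r$; type $c_k=\pm|S_k|$ with the sign of $S_k$; lattice word $S_1\cdots S_n$; rectangular if $\lambda^n_1=\cdots=\lambda^n_r$. Crystal operators (bracketing rule), $1\le i\le r-1$: write "[" under each letter containing $i$ but not $i+1$, or $-(i+1)$ but not $-i$; write "]" under each letter containing $i+1$ but not $i$, or $-i$ but not $-(i+1)$; match brackets from the inside out. $f_i$ acts on the letter with the leftmost unmatched "[" by replacing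 $i$ with $i+1$, or $-(i+1)$ with $-i$; $e_i$ acts on the letter with the rightmost unmatched "]" by replacing $i+1$ with $i$, or $-i$ with $-(i+1)$; either gives $0$ if no such unmatched bracket exists. -}

module Defs where

open import Data.Bool using (Bool; true; false; _∧_; not; if_then_else_)
open import Data.Nat as ℕ using (ℕ; zero; suc)
open import Data.Integer as ℤ using (ℤ; +_; -_; _+_; _≤_; _<_)
open import Data.Fin using (Fin; zero; suc; inject₁; fromℕ)
open import Data.Vec as Vec using (Vec; []; _∷_; lookup; replicate; zipWith)
open import Data.List as List using (List; []; _∷_; tabulate; last; map)
open import Data.List.Relation.Binary.Pointwise using (Pointwise)
open import Data.Maybe using (Maybe; just; nothing)
open import Data.Product using (_×_; _,_; proj₁; proj₂)
open import Data.Sum using (_⊎_)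
open import Data.Empty using (⊥)
open import Data.Unit using (⊤)
open import Relation.Binary.PropositionalEquality using (_≡_)

-- A letter is a sign (pos = true: subset of
-- {1..r}; pos = false: subset of {-1..-r}) together with the underlying
-- set of absolute values, as a characteristic vector: entry j (0-based)
-- of `set` says whether ±(j+1) belongs to the letter.

record Letter (r : ℕ) : Set where
  constructor mkLetter
  field
    pos : Bool
    set : Vec Bool r
open Letter public

card : ∀ {r} → Vec Bool r → ℕ
card []          = 0
card (true ∷ v)  = suc (card v)
card (false ∷ v) = card v

-- The empty set is a single element of 𝒜_r; we use the canonical
-- representative "positive empty". A letter is canonical if it is not a
-- negative empty letter.
Canonical : ∀ {r} → Letter r → Set
Canonical l with pos l
... | true  = ⊤
... | false = card (set l) ≡ 0 → ⊥

-- membership of the (1-based) absolute value k in the set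
has : ∀ {r} → Vec Bool r → ℕ → Bool
has []      _             = false
has (b ∷ v) zero          = false
has (b ∷ v) (suc zero)    = b
has (b ∷ v) (suc (suc k)) = has v (suc k)

setAt : ∀ {r} → Vec Bool r → ℕ → Bool → Vec Bool r
setAt []      _             _ = []
setAt (b ∷ v) zero          _ = b ∷ v
setAt (b ∷ v) (suc zero)    x = x ∷ v
setAt (b ∷ v) (suc (suc k)) x = b ∷ setAt v (suc k) x

typeOf : ∀ {r} → Letter r → ℤ
typeOf l = if pos l then + card (set l) else - (+ card (set l))

eVec : ∀ {r} → Letter r → Vec ℤ r
eVec l = Vec.map (λ b → if b then (if pos l then + 1 else - (+ 1)) else + 0) (set l)

LetterOfType : ∀ {r} → ℤ → Letter r → Set
LetterOfType c l =
  (+ 0 ≤ c × pos l ≡ true × + card (set l) ≡ c)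
  ⊎ (c < + 0 × pos l ≡ false × - (+ card (set l)) ≡ c)

InB : ∀ {r} → List ℤ → List (Letter r) → Set
InB c w = Pointwise (λ ck wk → LetterOfType ck wk) c w

data Br : Set where
  opn cls non : Br

bracket : ∀ {r} → ℕ → Letter r → Br
bracket i l with pos l | has (set l) i | has (set l) (suc i)
... | true  | true  | false = opn
... | true  | false | true  = cls
... | false | false | true  = opn
... | false | true  | false = cls
... | _     | _     | _     = non

-- Match brackets (a "]" matches the nearest unmatched "[" to its left,
-- i.e. matching from the inside out). Arguments: current position,
-- stack of positions of unmatched "[" (most recent first), positions of
-- unmatched "]" (most recent first).
scan : List Br → ℕ → List ℕ → List ℕ → List ℕ × List ℕ
scan []          k st       uc = st , uc
scan (opn ∷ bs)  k st       uc = scan bs (suc k) (k ∷ st) uc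
scan (cls ∷ bs)  k (_ ∷ st) uc = scan bs (suc k) st uc
scan (cls ∷ bs)  k []       uc = scan bs (suc k) [] (k ∷ uc)
scan (non ∷ bs)  k st       uc = scan bs (suc k) st uc

unmatched : ∀ {r} → ℕ → List (Letter r) → List ℕ × List ℕ
unmatched i w = scan (map (bracket i) w) 0 [] []

leftmostOpen : ∀ {r} → ℕ → List (Letter r) → Maybe ℕ
leftmostOpen i w = last (proj₁ (unmatched i w))

rightmostClose : ∀ {r} → ℕ → List (Letter r) → Maybe ℕ
rightmostClose i w with proj₂ (unmatched i w)
... | []    = nothing
... | k ∷ _ = just k

modifyAt : ∀ {A : Set} → ℕ → (A → A) → List A → List A
modifyAt _       g []       = []
modifyAt zero    g (x ∷ xs) = g x ∷ xs
modifyAt (suc k) g (x ∷ xs) = x ∷ modifyAt k g xs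

fLetter : ∀ {r} → ℕ → Letter r → Letter r
fLetter i (mkLetter true  s) = mkLetter true  (setAt (setAt s i false) (suc i) true)
fLetter i (mkLetter false s) = mkLetter false (setAt (setAt s (suc i) false) i true)

eLetter : ∀ {r} → ℕ → Letter r → Letter r
eLetter i (mkLetter true  s) = mkLetter true  (setAt (setAt s (suc i) false) i true)
eLetter i (mkLetter false s) = mkLetter false (setAt (setAt s i false) (suc i) true)

-- crystal operators; `nothing` plays the role of 0
f : ∀ {r} → ℕ → List (Letter r) → Maybe (List (Letter r))
f i w with leftmostOpen i w
... | nothing = nothing
... | just k  = just (modifyAt k (fLetter i) w)

e : ∀ {r} → ℕ → List (Letter r) → Maybe (List (Letter r))
e i w with rightmostClose i w
... | nothing = nothing
... | just k  = just (modifyAt k (eLetter i) w)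

Isolated : (r : ℕ) → List (Letter r) → Set
Isolated r w = ∀ (i : ℕ) → 1 ℕ.≤ i → i ℕ.< r → e i w ≡ nothing × f i w ≡ nothing

data WeaklyDecreasing : ∀ {r} → Vec ℤ r → Set where
  wd[]  : WeaklyDecreasing []
  wd[x] : ∀ {x} → WeaklyDecreasing (x ∷ [])
  wd∷   : ∀ {r x y} {v : Vec ℤ r} → y ≤ x →
          WeaklyDecreasing (y ∷ v) → WeaklyDecreasing (x ∷ y ∷ v)

record FluctuatingTableau (r n : ℕ) : Set where
  field
    shape     : Fin (suc n) → Vec ℤ r
    step      : Fin n → Letter r
    canonical : ∀ k → Canonical (step k)
    start     : shape zero ≡ replicate r (+ 0)
    next      : ∀ k → shape (suc k) ≡ zipWith _+_ (shape (inject₁ k)) (eVec (step k))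
    decr      : ∀ k → WeaklyDecreasing (shape k)
open FluctuatingTableau public

latticeWord : ∀ {r n} → FluctuatingTableau r n → List (Letter r)
latticeWord T = tabulate (step T)

tableauType : ∀ {r n} → FluctuatingTableau r n → List ℤ
tableauType T = tabulate (λ k → typeOf (step T k))

Rectangular : ∀ {r n} → FluctuatingTableau r n → Set
Rectangular {r} {n} T = ∀ (j j' : Fin r) → lookup (shape T (fromℕ n)) j ≡ lookup (shape T (fromℕ n)) j'

{-# OPTIONS --safe #-}
module Submission where

-- For each 1 ≤ i < r, adding e_S to a shape λ changes the gap λ_i − λ_{i+1}
-- by +1, −1 or 0 according as the letter S carries "[", "]" or no bracket for
-- the operator of index i.  Hence the shapes λ⁰ = 0, λ¹, … of a word are all
-- weakly decreasing with a rectangular last one exactly when, for every i, the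
-- bracket word never dips below height 0 and ends at height 0.  By the
-- bracketing rule this balance says that no bracket is left unmatched, that
-- is, e_i w = 0 and f_i w = 0.

open import Defs
open import Data.Bool using (Bool; true; false; if_then_else_)
open import Data.Nat as ℕ using (ℕ; zero; suc; z≤n; s≤s)
open import Data.Integer as ℤ using (ℤ; +_; -_; _+_; _-_; _≤_; +≤+; -<+; 0ℤ; 1ℤ; -1ℤ)
import Data.Integer.Properties as ℤ
open import Data.Integer.Tactic.RingSolver using (solve-∀)
open import Data.Fin using (Fin; zero; suc; inject₁; fromℕ)
open import Data.Vec as Vec using (Vec; []; _∷_; lookup; replicate; zipWith)
open import Data.List as List using (List; []; _∷_; tabulate; last; map; length)
open import Data.List.Properties using (tabulate-lookup)
open import Data.List.Relation.Binary.Pointwise using ([]; _∷_)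
open import Data.List.Relation.Unary.All using (All)
open import Data.Maybe using (just; nothing)
open import Data.Product using (Σ; _×_; _,_; proj₁; proj₂)
open import Data.Sum using (inj₁; inj₂)
open import Data.Empty using (⊥-elim)
open import Data.Unit using (tt)
open import Function.Bundles using (_⇔_; mk⇔; Equivalence)
open import Relation.Binary.PropositionalEquality

open Equivalence using (to; from)

weight : Br → ℤ
weight opn = 1ℤ
weight cls = -1ℤ
weight non = 0ℤ

Balanced : ℤ → List Br → Set
Balanced h []       = h ≡ 0ℤ
Balanced h (b ∷ bs) = 0ℤ ≤ weight b + h × Balanced (weight b + h) bs

brackets : ∀ {r} → ℕ → List (Letter r) → List Br
brackets i = map (bracket i)

scan-keepsUnmatchedCloses : ∀ bs k st uc → proj₂ (scan bs k st uc) ≡ [] → uc ≡ []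
scan-keepsUnmatchedCloses []         k st       uc p = p
scan-keepsUnmatchedCloses (opn ∷ bs) k st       uc p = scan-keepsUnmatchedCloses bs (suc k) (k ∷ st) uc p
scan-keepsUnmatchedCloses (cls ∷ bs) k (_ ∷ st) uc p = scan-keepsUnmatchedCloses bs (suc k) st uc p
scan-keepsUnmatchedCloses (cls ∷ bs) k []       uc p with () ← scan-keepsUnmatchedCloses bs (suc k) [] (k ∷ uc) p
scan-keepsUnmatchedCloses (non ∷ bs) k st       uc p = scan-keepsUnmatchedCloses bs (suc k) st uc p

-- The stack of pending "[" has exactly the current height as its length.
scan-allMatched⇔balanced : ∀ bs k st →
  (proj₁ (scan bs k st []) ≡ [] × proj₂ (scan bs k st []) ≡ []) ⇔ Balanced (+ length st) bs
scan-allMatched⇔balanced bs k st = mk⇔ (⇒ bs k st) (⇐ bs k st)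
  where
  ⇒ : ∀ bs k st → proj₁ (scan bs k st []) ≡ [] × proj₂ (scan bs k st []) ≡ [] → Balanced (+ length st) bs
  ⇒ []         k []       _        = refl
  ⇒ []         k (_ ∷ _)  (() , _)
  ⇒ (opn ∷ bs) k st       p        = +≤+ z≤n , ⇒ bs (suc k) (k ∷ st) p
  ⇒ (cls ∷ bs) k (_ ∷ st) p        = +≤+ z≤n , ⇒ bs (suc k) st p
  ⇒ (cls ∷ bs) k []       (_ , q)  with () ← scan-keepsUnmatchedCloses bs (suc k) [] (k ∷ []) q
  ⇒ (non ∷ bs) k st       p        = +≤+ z≤n , ⇒ bs (suc k) st p

  ⇐ : ∀ bs k st → Balanced (+ length st) bs → proj₁ (scan bs k st []) ≡ [] × proj₂ (scan bs k st []) ≡ []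
  ⇐ []         k []       _       = refl , refl
  ⇐ []         k (_ ∷ _)  ()
  ⇐ (opn ∷ bs) k st       (_ , b) = ⇐ bs (suc k) (k ∷ st) b
  ⇐ (cls ∷ bs) k (_ ∷ st) (_ , b) = ⇐ bs (suc k) st b
  ⇐ (cls ∷ bs) k []       (() , _)
  ⇐ (non ∷ bs) k st       (_ , b) = ⇐ bs (suc k) st b

last≡nothing⇒≡[] : ∀ {A : Set} (xs : List A) → last xs ≡ nothing → xs ≡ []
last≡nothing⇒≡[] []           _ = refl
last≡nothing⇒≡[] (_ ∷ [])     ()
last≡nothing⇒≡[] (_ ∷ y ∷ xs) p with () ← last≡nothing⇒≡[] (y ∷ xs) p

e≡nothing⇔ : ∀ {r} i (w : List (Letter r)) → e i w ≡ nothing ⇔ proj₂ (unmatched i w) ≡ []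
e≡nothing⇔ i w with proj₂ (unmatched i w)
... | []    = mk⇔ (λ _ → refl) (λ _ → refl)
... | _ ∷ _ = mk⇔ (λ ()) (λ ())

f≡nothing⇔ : ∀ {r} i (w : List (Letter r)) → f i w ≡ nothing ⇔ leftmostOpen i w ≡ nothing
f≡nothing⇔ i w with leftmostOpen i w
... | nothing = mk⇔ (λ _ → refl) (λ _ → refl)
... | just _  = mk⇔ (λ ()) (λ ())

isolatedAt⇔balanced : ∀ {r} i (w : List (Letter r)) →
  (e i w ≡ nothing × f i w ≡ nothing) ⇔ Balanced 0ℤ (brackets i w)
isolatedAt⇔balanced i w = mk⇔
  (λ (p , q) → to allMatched⇔ (last≡nothing⇒≡[] _ (to (f≡nothing⇔ i w) q) , to (e≡nothing⇔ i w) p))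
  (λ b → let (p , q) = from allMatched⇔ b in
         from (e≡nothing⇔ i w) q , from (f≡nothing⇔ i w) (cong last p))
  where
  allMatched⇔ : (proj₁ (unmatched i w) ≡ [] × proj₂ (unmatched i w) ≡ []) ⇔ Balanced 0ℤ (brackets i w)
  allMatched⇔ = scan-allMatched⇔balanced (brackets i w) 0 []

-- 1-based like `has`; the junk value 0 outside 1..r is never used.
coord : ∀ {r} → Vec ℤ r → ℕ → ℤ
coord []      _             = 0ℤ
coord (_ ∷ _) zero          = 0ℤ
coord (x ∷ _) (suc zero)    = x
coord (_ ∷ v) (suc (suc k)) = coord v (suc k)

gap : ∀ {r} → ℕ → Vec ℤ r → ℤ
gap i v = coord v i - coord v (suc i)

AllRowPairs : ℕ → (ℕ → Set) → Set
AllRowPairs r P = ∀ i → 1 ℕ.≤ i → i ℕ.< r → P i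

coord-zipWith-+ : ∀ {r} (u v : Vec ℤ r) i → coord (zipWith _+_ u v) i ≡ coord u i + coord v i
coord-zipWith-+ []      []      _             = refl
coord-zipWith-+ (_ ∷ _) (_ ∷ _) zero          = refl
coord-zipWith-+ (_ ∷ _) (_ ∷ _) (suc zero)    = refl
coord-zipWith-+ (_ ∷ u) (_ ∷ v) (suc (suc k)) = coord-zipWith-+ u v (suc k)

coord-indicator : ∀ {r} (x : ℤ) (s : Vec Bool r) i →
  coord (Vec.map (λ b → if b then x else 0ℤ) s) i ≡ (if has s i then x else 0ℤ)
coord-indicator x []      _             = refl
coord-indicator x (_ ∷ _) zero          = refl
coord-indicator x (_ ∷ _) (suc zero)    = refl
coord-indicator x (_ ∷ s) (suc (suc k)) = coord-indicator x s (suc k)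

coord-replicate-0 : ∀ r i → coord (replicate r 0ℤ) i ≡ 0ℤ
coord-replicate-0 zero    _             = refl
coord-replicate-0 (suc r) zero          = refl
coord-replicate-0 (suc r) (suc zero)    = refl
coord-replicate-0 (suc r) (suc (suc k)) = coord-replicate-0 r (suc k)

gap-zipWith-+ : ∀ {r} i (u v : Vec ℤ r) → gap i (zipWith _+_ u v) ≡ gap i v + gap i u
gap-zipWith-+ i u v
  rewrite coord-zipWith-+ u v i | coord-zipWith-+ u v (suc i) =
    rearrange (coord u i) (coord v i) (coord u (suc i)) (coord v (suc i))
  where
  rearrange : ∀ a b c d → (a + b) - (c + d) ≡ (b - d) + (a - c)
  rearrange = solve-∀

gap-eVec : ∀ {r} i (l : Letter r) → gap i (eVec l) ≡ weight (bracket i l)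
gap-eVec i (mkLetter p s)
  rewrite coord-indicator (if p then 1ℤ else -1ℤ) s i | coord-indicator (if p then 1ℤ else -1ℤ) s (suc i)
  with p | has s i | has s (suc i)
... | true  | true  | true  = refl
... | true  | true  | false = refl
... | true  | false | true  = refl
... | true  | false | false = refl
... | false | true  | true  = refl
... | false | true  | false = refl
... | false | false | true  = refl
... | false | false | false = refl

gap-step : ∀ {r} i (v : Vec ℤ r) (l : Letter r) →
  gap i (zipWith _+_ v (eVec l)) ≡ weight (bracket i l) + gap i v
gap-step i v l = trans (gap-zipWith-+ i v (eVec l)) (cong (_+ gap i v) (gap-eVec i l))

gap-replicate-0 : ∀ r i → gap i (replicate r 0ℤ) ≡ 0ℤ
gap-replicate-0 r i rewrite coord-replicate-0 r i | coord-replicate-0 r (suc i) = refl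

AllEqual : ∀ {r} → Vec ℤ r → Set
AllEqual v = ∀ j j' → lookup v j ≡ lookup v j'

gaps-tail : ∀ {r} (P : ℤ → Set) x (v : Vec ℤ r) →
  AllRowPairs (suc r) (λ i → P (gap i (x ∷ v))) → AllRowPairs r (λ i → P (gap i v))
gaps-tail P x v all (suc k) _ k<r = all (suc (suc k)) (s≤s z≤n) (s≤s k<r)

weaklyDecreasing⇔gaps-nonneg : ∀ {r} (v : Vec ℤ r) →
  WeaklyDecreasing v ⇔ AllRowPairs r (λ i → 0ℤ ≤ gap i v)
weaklyDecreasing⇔gaps-nonneg v = mk⇔ (⇒ v) (⇐ v)
  where
  ⇒ : ∀ {r} (v : Vec ℤ r) → WeaklyDecreasing v → AllRowPairs r (λ i → 0ℤ ≤ gap i v)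
  ⇒ (x ∷ y ∷ v) (wd∷ y≤x _)  (suc zero)    _ _           = ℤ.i≤j⇒0≤j-i y≤x
  ⇒ (x ∷ y ∷ v) (wd∷ _ wd)   (suc (suc k)) _ (s≤s k<r)   = ⇒ (y ∷ v) wd (suc k) (s≤s z≤n) k<r
  ⇒ (x ∷ [])    _            (suc zero)    _ (s≤s ())
  ⇒ (x ∷ [])    _            (suc (suc k)) _ (s≤s ())

  ⇐ : ∀ {r} (v : Vec ℤ r) → AllRowPairs r (λ i → 0ℤ ≤ gap i v) → WeaklyDecreasing v
  ⇐ []          _   = wd[]
  ⇐ (x ∷ [])    _   = wd[x]
  ⇐ (x ∷ y ∷ v) all = wd∷ (ℤ.0≤i-j⇒j≤i (all 1 (s≤s z≤n) (s≤s (s≤s z≤n))))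
                          (⇐ (y ∷ v) (gaps-tail (0ℤ ≤_) x (y ∷ v) all))

allEqual⇔gaps-zero : ∀ {r} (v : Vec ℤ r) → AllEqual v ⇔ AllRowPairs r (λ i → gap i v ≡ 0ℤ)
allEqual⇔gaps-zero v = mk⇔ (⇒ v) (⇐ v)
  where
  ⇒ : ∀ {r} (v : Vec ℤ r) → AllEqual v → AllRowPairs r (λ i → gap i v ≡ 0ℤ)
  ⇒ (x ∷ y ∷ v) eq (suc zero)    _ _         = ℤ.i≡j⇒i-j≡0 (eq zero (suc zero))
  ⇒ (x ∷ y ∷ v) eq (suc (suc k)) _ (s≤s k<r) = ⇒ (y ∷ v) (λ j j' → eq (suc j) (suc j')) (suc k) (s≤s z≤n) k<r
  ⇒ (x ∷ [])    _  (suc zero)    _ (s≤s ())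
  ⇒ (x ∷ [])    _  (suc (suc k)) _ (s≤s ())

  lookup≡head : ∀ {r} x (v : Vec ℤ r) → AllRowPairs (suc r) (λ i → gap i (x ∷ v) ≡ 0ℤ) →
    ∀ j → lookup (x ∷ v) j ≡ x
  lookup≡head x v       _   zero    = refl
  lookup≡head x (y ∷ v) all (suc j) =
    trans (lookup≡head y v (gaps-tail (_≡ 0ℤ) x (y ∷ v) all) j)
          (sym (ℤ.i-j≡0⇒i≡j x y (all 1 (s≤s z≤n) (s≤s (s≤s z≤n)))))

  ⇐ : ∀ {r} (v : Vec ℤ r) → AllRowPairs r (λ i → gap i v ≡ 0ℤ) → AllEqual v
  ⇐ (x ∷ v) all j j' = trans (lookup≡head x v all j) (sym (lookup≡head x v all j'))

infixl 6 _⊕_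
_⊕_ : ∀ {r} → Vec ℤ r → Letter r → Vec ℤ r
v ⊕ l = zipWith _+_ v (eVec l)

Admissible : ∀ {r} → Vec ℤ r → List (Letter r) → Set
Admissible v []      = AllEqual v
Admissible v (l ∷ w) = WeaklyDecreasing (v ⊕ l) × Admissible (v ⊕ l) w

admissible⇔balanced : ∀ {r} (v : Vec ℤ r) w →
  Admissible v w ⇔ AllRowPairs r (λ i → Balanced (gap i v) (brackets i w))
admissible⇔balanced v w = mk⇔ (⇒ v w) (⇐ v w)
  where
  ⇒ : ∀ {r} (v : Vec ℤ r) w → Admissible v w → AllRowPairs r (λ i → Balanced (gap i v) (brackets i w))
  ⇒ v []      eq         = to (allEqual⇔gaps-zero v) eq
  ⇒ v (l ∷ w) (wd , adm) i 1≤i i<r =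
    subst (0ℤ ≤_) (gap-step i v l) (to (weaklyDecreasing⇔gaps-nonneg (v ⊕ l)) wd i 1≤i i<r) ,
    subst (λ h → Balanced h (brackets i w)) (gap-step i v l) (⇒ (v ⊕ l) w adm i 1≤i i<r)

  ⇐ : ∀ {r} (v : Vec ℤ r) w → AllRowPairs r (λ i → Balanced (gap i v) (brackets i w)) → Admissible v w
  ⇐ v []      bal = from (allEqual⇔gaps-zero v) bal
  ⇐ v (l ∷ w) bal =
    from (weaklyDecreasing⇔gaps-nonneg (v ⊕ l))
      (λ i 1≤i i<r → subst (0ℤ ≤_) (sym (gap-step i v l)) (proj₁ (bal i 1≤i i<r))) ,
    ⇐ (v ⊕ l) w
      (λ i 1≤i i<r → subst (λ h → Balanced h (brackets i w)) (sym (gap-step i v l)) (proj₂ (bal i 1≤i i<r)))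

isolated⇔admissible : ∀ r (w : List (Letter r)) → Isolated r w ⇔ Admissible (replicate r 0ℤ) w
isolated⇔admissible r w = mk⇔
  (λ iso → from (admissible⇔balanced (replicate r 0ℤ) w) λ i 1≤i i<r →
     subst (λ h → Balanced h (brackets i w)) (sym (gap-replicate-0 r i))
           (to (isolatedAt⇔balanced i w) (iso i 1≤i i<r)))
  (λ adm i 1≤i i<r → from (isolatedAt⇔balanced i w)
     (subst (λ h → Balanced h (brackets i w)) (gap-replicate-0 r i)
            (to (admissible⇔balanced (replicate r 0ℤ) w) adm i 1≤i i<r)))

shapesFrom : ∀ {r} → Vec ℤ r → (w : List (Letter r)) → Fin (suc (length w)) → Vec ℤ r
shapesFrom v w       zero    = v
shapesFrom v (l ∷ w) (suc k) = shapesFrom (v ⊕ l) w k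

shapesFrom-next : ∀ {r} (v : Vec ℤ r) w (k : Fin (length w)) →
  shapesFrom v w (suc k) ≡ shapesFrom v w (inject₁ k) ⊕ List.lookup w k
shapesFrom-next v (l ∷ w) zero    = refl
shapesFrom-next v (l ∷ w) (suc k) = shapesFrom-next (v ⊕ l) w k

shapesFrom-weaklyDecreasing : ∀ {r} (v : Vec ℤ r) w → WeaklyDecreasing v → Admissible v w →
  ∀ k → WeaklyDecreasing (shapesFrom v w k)
shapesFrom-weaklyDecreasing v w       wd _          zero    = wd
shapesFrom-weaklyDecreasing v (l ∷ w) _  (wd , adm) (suc k) = shapesFrom-weaklyDecreasing (v ⊕ l) w wd adm k

shapesFrom-last-allEqual : ∀ {r} (v : Vec ℤ r) w → Admissible v w → AllEqual (shapesFrom v w (fromℕ (length w)))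
shapesFrom-last-allEqual v []      eq        = eq
shapesFrom-last-allEqual v (l ∷ w) (_ , adm) = shapesFrom-last-allEqual (v ⊕ l) w adm

replicate-0-weaklyDecreasing : ∀ r → WeaklyDecreasing (replicate r 0ℤ)
replicate-0-weaklyDecreasing zero          = wd[]
replicate-0-weaklyDecreasing (suc zero)    = wd[x]
replicate-0-weaklyDecreasing (suc (suc r)) = wd∷ ℤ.≤-refl (replicate-0-weaklyDecreasing (suc r))

wordTableau : ∀ {r} (w : List (Letter r)) → (∀ k → Canonical (List.lookup w k)) →
  Admissible (replicate r 0ℤ) w → FluctuatingTableau r (length w)
wordTableau {r} w canon adm = record
  { shape     = shapesFrom (replicate r 0ℤ) w
  ; step      = List.lookup w
  ; canonical = canon
  ; start     = refl
  ; next      = shapesFrom-next (replicate r 0ℤ) w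
  ; decr      = shapesFrom-weaklyDecreasing (replicate r 0ℤ) w (replicate-0-weaklyDecreasing r) adm
  }

admissible-tabulate : ∀ {r} m (sh : Fin (suc m) → Vec ℤ r) (st : Fin m → Letter r) →
  (∀ k → sh (suc k) ≡ sh (inject₁ k) ⊕ st k) → (∀ k → WeaklyDecreasing (sh k)) →
  AllEqual (sh (fromℕ m)) → Admissible (sh zero) (tabulate st)
admissible-tabulate zero    sh st next decr eq = eq
admissible-tabulate (suc m) sh st next decr eq =
  subst (λ v → WeaklyDecreasing v × Admissible v (tabulate (λ k → st (suc k)))) (next zero)
    (decr (suc zero) ,
     admissible-tabulate m (λ k → sh (suc k)) (λ k → st (suc k)) (λ k → next (suc k)) (λ k → decr (suc k)) eq)

tableau-admissible : ∀ {r n} (T : FluctuatingTableau r n) → Rectangular T →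
  Admissible (replicate r 0ℤ) (latticeWord T)
tableau-admissible {n = n} T rect =
  subst (λ v → Admissible v (latticeWord T)) (start T)
        (admissible-tabulate n (shape T) (step T) (next T) (decr T) rect)

letterOfType⇒canonical : ∀ {r c} (l : Letter r) → LetterOfType c l → Canonical l
letterOfType⇒canonical (mkLetter true  _) _                         = tt
letterOfType⇒canonical (mkLetter false _) (inj₁ (_ , () , _))
letterOfType⇒canonical (mkLetter false _) (inj₂ (c<0 , _ , refl)) empty
  rewrite empty = ℤ.<-irrefl refl c<0

letterOfType⇒typeOf : ∀ {r c} (l : Letter r) → LetterOfType c l → typeOf l ≡ c
letterOfType⇒typeOf (mkLetter true  _) (inj₁ (_ , _ , eq)) = eq
letterOfType⇒typeOf (mkLetter true  _) (inj₂ (_ , () , _))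
letterOfType⇒typeOf (mkLetter false _) (inj₁ (_ , () , _))
letterOfType⇒typeOf (mkLetter false _) (inj₂ (_ , _ , eq)) = eq

canonical⇒letterOfType : ∀ {r} (l : Letter r) → Canonical l → LetterOfType (typeOf l) l
canonical⇒letterOfType (mkLetter true  s) _ = inj₁ (+≤+ z≤n , refl , refl)
canonical⇒letterOfType (mkLetter false s) nonempty with card s
... | zero  = ⊥-elim (nonempty refl)
... | suc _ = inj₂ (-<+ , refl , refl)

inB⇒canonical : ∀ {r c} {w : List (Letter r)} → InB c w → ∀ k → Canonical (List.lookup w k)
inB⇒canonical (p ∷ _)  zero    = letterOfType⇒canonical _ p
inB⇒canonical (_ ∷ ps) (suc k) = inB⇒canonical ps k

inB⇒types : ∀ {r c} {w : List (Letter r)} → InB c w → tabulate (λ k → typeOf (List.lookup w k)) ≡ c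
inB⇒types               []       = refl
inB⇒types {w = l ∷ _} (p ∷ ps) = cong₂ _∷_ (letterOfType⇒typeOf l p) (inB⇒types ps)

inB-tabulate : ∀ {r} m (st : Fin m → Letter r) → (∀ k → Canonical (st k)) →
  InB (tabulate (λ k → typeOf (st k))) (tabulate st)
inB-tabulate zero    st canon = []
inB-tabulate (suc m) st canon =
  canonical⇒letterOfType (st zero) (canon zero) ∷ inB-tabulate m (λ k → st (suc k)) (λ k → canon (suc k))

corollary8p15 : (r : ℕ) (c : List ℤ) →
    All (λ ck → (- (+ r) ≤ ck) × (ck ≤ + r)) c →
    (w : List (Letter r)) →
    (InB c w × Isolated r w)
      ⇔ Σ ℕ (λ n → Σ (FluctuatingTableau r n) (λ T →
          Rectangular T × tableauType T ≡ c × latticeWord T ≡ w))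
corollary8p15 r c _ w = mk⇔
  (λ (inB , iso) →
    let adm = to (isolated⇔admissible r w) iso in
    length w , wordTableau w (inB⇒canonical inB) adm ,
    shapesFrom-last-allEqual (replicate r 0ℤ) w adm , inB⇒types inB , tabulate-lookup w)
  (λ { (n , T , rect , refl , refl) →
    inB-tabulate n (step T) (canonical T) ,
    from (isolated⇔admissible r (latticeWord T)) (tableau-admissible T rect) })
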